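{- Let $G=(V,E)$ be a graph and let $\le$ be a co-lex preorder on $G$. Then $\le^\sim$ is a co-lex order on $G/_\le$, and the width of $\le^\sim$ equals the width of $\le$.
   Context: $\Sigma$ is a finite alphabet with a fixed total order $\preceq$. A graph is $G=(V,E)$ with $V$ finite and $E\subseteq V\times V\times\Sigma$. Let $\#\notin\Sigma$ with $\#\prec a$ for all $a\in\Sigma$. For a node $v$ of a graph, $\lambda(v)$ is the set of labels of edges entering $v$ if $v$ has incoming edges, and $\{\#\}$ otherwise. Write $\lambda(u)\,\angle\,\lambda(v)$ iff $a\preceq b$ for all $a\in\lambda(u)$, $b\in\lambda(v)$. A co-lex relation on a graph is a reflexive relation $R$ on its nodes such that (Axiom 1) $u\neq v$, $(u,v)\in R$ implies $\lambda(u)\,\angle\,\lambda(v)$; (Axiom 2) for edges $(u',u,a),(v',v,a)$ with $u\neq v$ and $(u,v)\in R$, $(u',v')\in R$. A co-lex preorder (order) is a co-lex relation that is a preorder (partial order). For a preorder $\le$: $u\sim_\le v$ iff $u\le v$ and $v\le u$; $[v]_\le$ the class of $v$; $V/_\le$ the set of classes; $[u]_\le\le^\sim[v]_\le$ iff $u\le v$ (a partial order); $G/_\le=(V/_\le,E/_\le)$ with $E/_\le=\{([u]_\le,[v]_\le,a):(u',v',a)\in E$ for some $u'\in[u]_\le$, $v'\in[v]_\le\}$. The width of a preorder is the minimum size of a partition into sets of pairwise comparable elements. -}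

module Defs where

open import Data.Nat using (ℕ; suc)
open import Data.Fin using (Fin; zero; suc; _≤_)
open import Data.Product using (Σ; Σ-syntax; ∃; ∃-syntax; _×_; _,_)
open import Data.Sum using (_⊎_)
open import Relation.Nullary using (¬_)
open import Relation.Binary.PropositionalEquality using (_≡_; _≢_)
open import Function.Bundles using (_⇔_)

-- Conventions:
--  * the alphabet Σ with its fixed total order is Fin k with the usual order of Fin;
--  * a graph with n nodes has node set Fin n and edge relation E u v a  meaning (u,v,a) ∈ E;
--  * the extended label set Σ ∪ {#} is Fin (suc k): zero is #, suc a is the letter a,
--    so # precedes every letter.

Edges : ℕ → ℕ → Set₁
Edges k n = Fin n → Fin n → Fin k → Set

Rel : ℕ → Set₁
Rel n = Fin n → Fin n → Set

module _ {k n : ℕ} (E : Edges k n) where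

  HasNoIncoming : Fin n → Set
  HasNoIncoming v = ∀ u a → ¬ E u v a

  λ∋ : Fin n → Fin (suc k) → Set
  λ∋ v x = (∃[ u ] ∃[ a ] (E u v a × x ≡ suc a)) ⊎ (HasNoIncoming v × x ≡ zero)

  _∠_ : Fin n → Fin n → Set
  u ∠ v = ∀ x y → λ∋ u x → λ∋ v y → x ≤ y

  record IsCoLexRelation (R : Rel n) : Set where
    field
      refl  : ∀ v → R v v
      axiom1 : ∀ u v → u ≢ v → R u v → u ∠ v
      axiom2 : ∀ u′ u v′ v a → E u′ u a → E v′ v a → u ≢ v → R u v → R u′ v′

  record IsCoLexPreorder (R : Rel n) : Set where
    field
      isCoLexRelation : IsCoLexRelation R
      trans : ∀ u v w → R u v → R v w → R u w

  record IsCoLexOrder (R : Rel n) : Set where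
    field
      isCoLexPreorder : IsCoLexPreorder R
      antisym : ∀ u v → R u v → R v u → u ≡ v

Surjective : ∀ {n m} → (Fin n → Fin m) → Set
Surjective {n} {m} f = ∀ (y : Fin m) → ∃[ x ] f x ≡ y

_∼[_]_ : ∀ {n} → Fin n → Rel n → Fin n → Set
u ∼[ R ] v = R u v × R v u

-- π : Fin n → Fin m presents V/≤ : it is onto and identifies exactly the ∼-classes,
-- i.e. π u is (a name for) the class [u].
IsQuotientMap : ∀ {n m} → Rel n → (Fin n → Fin m) → Set
IsQuotientMap R π = Surjective π × (∀ u v → (π u ≡ π v) ⇔ (u ∼[ R ] v))

QuotientEdges : ∀ {k n m} → (Fin n → Fin m) → Edges k n → Edges k m
QuotientEdges π E x y a = ∃[ u′ ] ∃[ v′ ] (π u′ ≡ x × π v′ ≡ y × E u′ v′ a)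

QuotientRel : ∀ {n m} → Rel n → (Fin n → Fin m) → Rel m
QuotientRel R π x y = ∃[ u ] ∃[ v ] (π u ≡ x × π v ≡ y × R u v)

IsChainPartition : ∀ {n} → Rel n → (w : ℕ) → (Fin n → Fin w) → Set
IsChainPartition R w c = Surjective c × (∀ u v → c u ≡ c v → R u v ⊎ R v u)

HasWidth : ∀ {n} → Rel n → ℕ → Set
HasWidth {n} R w =
  (∃[ c ] IsChainPartition R w c) ×
  (∀ (w′ : ℕ) (c : Fin n → Fin w′) → IsChainPartition R w′ c → w Data.Nat.≤ w′)

{-# OPTIONS --safe #-}
module Submission where

-- Every class of ≤ is sent by π to a single point, so comparisons between
-- classes are comparisons between arbitrary representatives; the co-lex axioms
-- and transitivity of ≤ therefore descend to ≤^∼, and antisymmetry holds because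
-- π identifies exactly the ∼-classes. A chain partition of the quotient pulls
-- back along π to one of the same size, and a chain partition of G restricted
-- to a set of representatives is a chain partition of the quotient, after
-- discarding the unused blocks; hence both preorders have the same width.

open import Defs
open import Data.Nat using (ℕ; zero; suc; z≤n)
  renaming (_≤_ to _≤ℕ_)
open import Data.Nat.Properties using (≤-refl; ≤-trans; ≤-antisym; m≤n⇒m≤1+n)
open import Data.Fin using (Fin; punchOut)
open import Data.Fin.Properties using (any?; all?; ¬∀⟶∃¬; punchOut-injective; _≟_)
open import Data.Product using (_×_; _,_; proj₁; proj₂; ∃-syntax; Σ)
open import Data.Sum using (_⊎_; inj₁; inj₂)
import Data.Sum as Sum
open import Function using (_∘_)
open import Relation.Binary.PropositionalEquality
  using (_≡_; refl; sym; trans; cong; subst; _≢_)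
open import Function.Bundles using (_⇔_; mk⇔; Equivalence)
open import Relation.Nullary using (yes; no)

Kernel⊆ : ∀ {n w w′} → (Fin n → Fin w′) → (Fin n → Fin w) → Set
Kernel⊆ g f = ∀ x y → g x ≡ g y → f x ≡ f y

-- Each uncovered point of the codomain is removed by a punchOut.
surjective-refinement : ∀ {n} w (f : Fin n → Fin w) →
  ∃[ w′ ] w′ ≤ℕ w × Σ (Fin n → Fin w′) (λ g → Surjective g × Kernel⊆ g f)
surjective-refinement w f with all? (λ y → any? (λ x → f x ≟ y))
... | yes f-onto = w , ≤-refl , f , f-onto , λ _ _ e → e
surjective-refinement zero f | no _ = zero , z≤n , f , (λ ()) , λ _ _ e → e
surjective-refinement (suc w) f | no ¬onto
  with ¬∀⟶∃¬ (suc w) _ (λ y → any? (λ x → f x ≟ y)) ¬onto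
... | y , y∉image
  with surjective-refinement w (λ x → punchOut {i = y} {j = f x} (λ e → y∉image (x , sym e)))
... | w′ , w′≤w , g , g-onto , g⊆f =
  w′ , m≤n⇒m≤1+n w′≤w , g , g-onto ,
  λ x x′ e → punchOut-injective (λ e′ → y∉image (x , sym e′))
                                (λ e′ → y∉image (x′ , sym e′)) (g⊆f x x′ e)

IsChainColouring : ∀ {n} → Rel n → ∀ {w} → (Fin n → Fin w) → Set
IsChainColouring R c = ∀ u v → c u ≡ c v → R u v ⊎ R v u

chainColouring⇒chainPartition : ∀ {n} {R : Rel n} w (c : Fin n → Fin w) →
  IsChainColouring R c → ∃[ w′ ] w′ ≤ℕ w × ∃[ d ] IsChainPartition R w′ d
chainColouring⇒chainPartition w c c-chains with surjective-refinement w c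
... | w′ , w′≤w , d , d-onto , d⊆c =
  w′ , w′≤w , d , d-onto , λ u v e → c-chains u v (d⊆c u v e)

HasWidth-⇔ : ∀ {n m} {R : Rel n} {Q : Rel m} →
  (∀ w d → IsChainPartition Q w d → ∃[ c ] IsChainPartition R w c) →
  (∀ w c → IsChainPartition R w c → ∃[ w′ ] w′ ≤ℕ w × ∃[ d ] IsChainPartition Q w′ d) →
  ∀ w → HasWidth R w ⇔ HasWidth Q w
HasWidth-⇔ {R = R} {Q} Q⇒R R⇒Q w = mk⇔ to from
  where
  to : HasWidth R w → HasWidth Q w
  to ((c , c-part) , R-min) with R⇒Q w c c-part
  ... | w′ , w′≤w , d , d-part =
    subst (λ v → ∃[ d ] IsChainPartition Q v d)
          (≤-antisym w′≤w (R-min w′ _ (proj₂ (Q⇒R w′ d d-part))))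
          (d , d-part) ,
    λ w″ d′ d′-part → R-min w″ _ (proj₂ (Q⇒R w″ d′ d′-part))
  from : HasWidth Q w → HasWidth R w
  from ((d , d-part) , Q-min) =
    Q⇒R w d d-part ,
    λ w″ c c-part → let w′ , w′≤w″ , d′ , d′-part = R⇒Q w″ c c-part
                    in ≤-trans (Q-min w′ d′ d′-part) w′≤w″

module Quotient {k n m : ℕ} (E : Edges k n) (R : Rel n) (pre : IsCoLexPreorder E R)
                (π : Fin n → Fin m) (quotient : IsQuotientMap R π) where

  open IsCoLexPreorder pre renaming (trans to R-trans)
  open IsCoLexRelation isCoLexRelation renaming (refl to R-refl)

  E/ : Edges k m
  E/ = QuotientEdges π E

  R/ : Rel m
  R/ = QuotientRel R π

  rep : Fin m → Fin n
  rep x = proj₁ (proj₁ quotient x)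

  π∘rep : ∀ x → π (rep x) ≡ x
  π∘rep x = proj₂ (proj₁ quotient x)

  ∼⇔π≡ : ∀ u v → (π u ≡ π v) ⇔ (u ∼[ R ] v)
  ∼⇔π≡ = proj₂ quotient

  π≡⇒R : ∀ u v → π u ≡ π v → R u v
  π≡⇒R u v = proj₁ ∘ Equivalence.to (∼⇔π≡ u v)

  R/⇒R : ∀ {x y u v} → R/ x y → π u ≡ x → π v ≡ y → R u v
  R/⇒R {u = u} {v} (u₀ , v₀ , πu₀ , πv₀ , u₀≤v₀) πu πv =
    R-trans u u₀ v (π≡⇒R u u₀ (trans πu (sym πu₀)))
      (R-trans u₀ v₀ v u₀≤v₀ (π≡⇒R v₀ v (trans πv₀ (sym πv))))

  R/⇒R-rep : ∀ {x y} → R/ x y → R (rep x) (rep y)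
  R/⇒R-rep {x} {y} q = R/⇒R q (π∘rep x) (π∘rep y)

  R-rep⇒R/ : ∀ {x y} → R (rep x) (rep y) → R/ x y
  R-rep⇒R/ {x} {y} r = rep x , rep y , π∘rep x , π∘rep y , r

  π-respects-≢ : ∀ {x y u v} → π u ≡ x → π v ≡ y → x ≢ y → u ≢ v
  π-respects-≢ πu πv x≢y refl = x≢y (trans (sym πu) πv)

  -- A class without incoming edges consists of nodes without incoming edges,
  -- so # is the label of its representative.
  λ∋-lift : ∀ x l → λ∋ E/ x l → ∃[ v ] π v ≡ x × λ∋ E v l
  λ∋-lift x l (inj₁ (_ , a , (u , v , _ , πv , e) , l≡a)) = v , πv , inj₁ (u , a , e , l≡a)
  λ∋-lift x l (inj₂ (no-in , l≡#)) =
    rep x , π∘rep x ,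
    inj₂ ((λ u a e → no-in (π u) a (u , rep x , refl , π∘rep x , e)) , l≡#)

  R/-refl : ∀ x → R/ x x
  R/-refl x = R-rep⇒R/ (R-refl (rep x))

  R/-axiom1 : ∀ x y → x ≢ y → R/ x y → _∠_ E/ x y
  R/-axiom1 x y x≢y q l₁ l₂ l₁∈x l₂∈y with λ∋-lift x l₁ l₁∈x | λ∋-lift y l₂ l₂∈y
  ... | u , πu , l₁∈u | v , πv , l₂∈v =
    axiom1 u v (π-respects-≢ πu πv x≢y) (R/⇒R q πu πv) l₁ l₂ l₁∈u l₂∈v

  R/-axiom2 : ∀ x′ x y′ y a → E/ x′ x a → E/ y′ y a → x ≢ y → R/ x y → R/ x′ y′
  R/-axiom2 x′ x y′ y a (u′ , u , πu′ , πu , e₁) (v′ , v , πv′ , πv , e₂) x≢y q =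
    u′ , v′ , πu′ , πv′ ,
    axiom2 u′ u v′ v a e₁ e₂ (π-respects-≢ πu πv x≢y) (R/⇒R q πu πv)

  R/-trans : ∀ x y z → R/ x y → R/ y z → R/ x z
  R/-trans x y z q₁ q₂ =
    R-rep⇒R/ (R-trans (rep x) (rep y) (rep z) (R/⇒R-rep q₁) (R/⇒R-rep q₂))

  R/-antisym : ∀ x y → R/ x y → R/ y x → x ≡ y
  R/-antisym x y q₁ q₂ = begin
    x           ≡⟨ sym (π∘rep x) ⟩
    π (rep x)   ≡⟨ Equivalence.from (∼⇔π≡ (rep x) (rep y)) (R/⇒R-rep q₁ , R/⇒R-rep q₂) ⟩
    π (rep y)   ≡⟨ π∘rep y ⟩
    y           ∎
    where open Relation.Binary.PropositionalEquality.≡-Reasoning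

  isCoLexOrder : IsCoLexOrder E/ R/
  isCoLexOrder = record
    { isCoLexPreorder = record
      { isCoLexRelation = record { refl = R/-refl ; axiom1 = R/-axiom1 ; axiom2 = R/-axiom2 }
      ; trans = R/-trans }
    ; antisym = R/-antisym }

  chainPartition-pullback : ∀ w d → IsChainPartition R/ w d → IsChainPartition R w (d ∘ π)
  chainPartition-pullback w d (d-onto , d-chains) =
    (λ j → let x , dx≡j = d-onto j in rep x , trans (cong d (π∘rep x)) dx≡j) ,
    λ u v e → Sum.map (λ q → R/⇒R q refl refl) (λ q → R/⇒R q refl refl) (d-chains (π u) (π v) e)

  chainPartition-restrict : ∀ w c → IsChainPartition R w c → IsChainColouring R/ (c ∘ rep)
  chainPartition-restrict w c (_ , c-chains) x y e =
    Sum.map R-rep⇒R/ R-rep⇒R/ (c-chains (rep x) (rep y) e)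

  width-preserved : ∀ w → HasWidth R w ⇔ HasWidth R/ w
  width-preserved = HasWidth-⇔
    (λ w d d-part → d ∘ π , chainPartition-pullback w d d-part)
    (λ w c c-part → chainColouring⇒chainPartition w (c ∘ rep) (chainPartition-restrict w c c-part))

lemma11 : ∀ {k n : ℕ} (E : Edges k n) (R : Rel n) → IsCoLexPreorder E R →
    ∀ {m : ℕ} (π : Fin n → Fin m) → IsQuotientMap R π →
    IsCoLexOrder (QuotientEdges π E) (QuotientRel R π) ×
    (∀ (w : ℕ) → HasWidth R w ⇔ HasWidth (QuotientRel R π) w)
lemma11 E R pre π quotient = isCoLexOrder , width-preserved
  where open Quotient E R pre π quotient
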